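{- Let $k\ge2$ and let $(a(n))_{n\ge0}$, $(b(n))_{n\ge0}$ be $k$-automatic sequences. Then the sequence $(c(n))_{n\ge0}$ defined by $c(n)=1$ if $a(nk^\lambda+s)=b(nk^\lambda+s)$ for all $\lambda\ge0$ and all $0\le s<k^\lambda$, and $c(n)=0$ otherwise, is $k$-automatic.
   Context: A sequence is $k$-automatic if it is produced by a finite automaton with output reading the base-$k$ expansion of $n$: $a(n)=\tau(\delta(q_0,(n)_k))$. -}

module Defs where

open import Data.Nat using (ℕ; zero; suc; _+_; _*_; _^_; _<_; _≤_; NonZero)
open import Data.Nat.DivMod using (_/_; _%_; m%n<n)
open import Data.Fin using (Fin; fromℕ<)
open import Data.List using (List; []; _∷_; _∷ʳ_; foldl)
open import Data.Product using (Σ; ∃; _×_; _,_)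
open import Relation.Binary.PropositionalEquality using (_≡_)

-- Base-k expansion of n, most significant digit first, no leading zeros
-- (so (0)_k is the empty word).  Computed with fuel: `fuel` recursive
-- steps suffice whenever fuel ≥ n, since n/k < n for n ≥ 1, k ≥ 2.
digitsAux : (k : ℕ) → .{{_ : NonZero k}} → ℕ → ℕ → List (Fin k)
digitsAux k zero n = []
digitsAux k (suc fuel) zero = []
digitsAux k (suc fuel) n@(suc _) =
  digitsAux k fuel (n / k) ∷ʳ fromℕ< (m%n<n n k)

digits : (k : ℕ) → .{{_ : NonZero k}} → ℕ → List (Fin k)
digits k n = digitsAux k n n

record DFAO (k : ℕ) (Δ : Set) : Set where
  field
    m  : ℕ
    q₀ : Fin m
    δ  : Fin m → Fin k → Fin m
    τ  : Fin m → Δ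


run : ∀ {k Δ} .{{_ : NonZero k}} → DFAO k Δ → ℕ → Δ
run {k} M n = DFAO.τ M (foldl (DFAO.δ M) (DFAO.q₀ M) (digits k n))

Automatic : (k : ℕ) .{{_ : NonZero k}} → {Δ : Set} → (ℕ → Δ) → Set
Automatic k {Δ} a = Σ (DFAO k Δ) λ M → ∀ n → run M n ≡ a n

{-# OPTIONS --safe #-}
-- Run a and b in parallel, in an automaton M whose initial state is fixed by
-- the digit 0, so that the state reached on n k^λ + s is determined by the
-- state reached on n together with λ and s.  Whether a and b agree on all
-- these extensions of n is then a property of the state of M on n alone, and
-- c is obtained from M by relabelling each state with the value of c at a
-- number reaching it; such a number exists for every reachable state, and can
-- be found among the words of length at most the number of states.
module Submission where

open import Defs
import Data.Nat as ℕ
open import Data.Nat using (ℕ; zero; suc; _+_; _*_; _^_; _<_; _≤_; NonZero; s≤s; z≤n)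
open import Data.Nat.Properties
  using (_≤?_; ≰⇒>; ≤-pred; <⇒≤; ≤-refl; ≤-trans; *-comm; *-identityʳ; +-identityʳ; +-comm; m+n≡0⇒m≡0; m+n≡0⇒n≡0; m*n≡0⇒m≡0)
open import Data.Nat.DivMod using (_/_; _%_; m%n<n; m≡m%n+[m/n]*n; m/n<m; m<n*o⇒m/o<n; m*n/n≡m; m<n⇒m/n≡0; m<n⇒m%n≡m; [m+kn]%n≡m%n; +-distrib-/-∣ˡ)
open import Data.Nat.Divisibility using (n∣m*n)
open import Data.Nat.Induction using (<-rec)
open import Data.Nat.Solver using (module +-*-Solver)
open import Data.Fin as Fin using (Fin; zero; suc; toℕ; fromℕ<; combine; remQuot)
open import Data.Fin.Properties using (toℕ-fromℕ<; toℕ-injective; toℕ<n; remQuot-combine; pigeonhole; any?)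
open import Data.List using (List; []; _∷_; _∷ʳ_; foldl; length; lookup)
open import Data.List.Properties using (foldl-∷ʳ)
open import Data.List.Relation.Unary.All as All using ([]; _∷_)
open import Data.List.Relation.Unary.AllPairs using ([]; _∷_)
open import Data.List.Relation.Unary.All.Properties using (¬Any⇒All¬)
open import Data.List.Relation.Unary.Any using (here; there)
open import Data.List.Relation.Unary.Unique.Propositional using (Unique)
open import Data.List.Membership.Propositional using (_∈_)
open import Data.List.Membership.Propositional.Properties using (∈-lookup)
open import Data.Product using (Σ; _×_; _,_; proj₁; proj₂)
open import Data.Product.Properties using (,-injective)
open import Data.Sum using (_⊎_; inj₁; inj₂)
open import Data.Empty using (⊥-elim)
open import Relation.Nullary using (¬_; Dec; yes; no; contradiction)
open import Relation.Binary.PropositionalEquality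
  using (_≡_; _≢_; refl; sym; trans; cong; cong₂; subst; subst₂; module ≡-Reasoning)

open ≡-Reasoning

lookup-distinct : ∀ {A : Set} {xs : List A} → Unique xs →
                  ∀ {i j} → i Fin.< j → lookup xs i ≢ lookup xs j
lookup-distinct {xs = _ ∷ _} (x∉xs ∷ _) {zero} {suc j} _ = All.lookup x∉xs (∈-lookup j)
lookup-distinct {xs = _ ∷ _} (_ ∷ u) {suc i} {suc j} (s≤s i<j) = lookup-distinct u i<j

Unique⇒length≤ : ∀ {n} {xs : List (Fin n)} → Unique xs → length xs ≤ n
Unique⇒length≤ {n} {xs} u with length xs ≤? n
... | yes ≤n = ≤n
... | no ≰n with pigeonhole (≰⇒> ≰n) (lookup xs)
...   | _ , _ , i<j , eq = contradiction eq (lookup-distinct u i<j)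

module Reachability {m k : ℕ} (δ : Fin m → Fin k → Fin m) where

  open import Data.List.Membership.DecPropositional (Fin._≟_ {m}) using (_∈?_)

  ReachableWithin : ℕ → Fin m → Fin m → Set
  ReachableWithin j p t = Σ (List (Fin k)) λ w → length w ≤ j × foldl δ p w ≡ t

  reachableWithin? : ∀ j p t → Dec (ReachableWithin j p t)
  reachableWithin? j p t with p Fin.≟ t
  ... | yes p≡t = yes ([] , z≤n , p≡t)
  reachableWithin? zero p t | no p≢t = no λ where
    ([] , _ , p≡t) → p≢t p≡t
    (_ ∷ _ , () , _)
  reachableWithin? (suc j) p t | no p≢t with any? (λ d → reachableWithin? j (δ p d) t)
  ... | yes (d , w , ∣w∣≤j , reach) = yes (d ∷ w , s≤s ∣w∣≤j , reach)
  ... | no ¬next = no λ where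
    ([] , _ , p≡t) → p≢t p≡t
    (d ∷ w , s≤s ∣w∣≤j , reach) → ¬next (d , w , ∣w∣≤j , reach)

  visits : Fin m → List (Fin k) → List (Fin m)
  visits p [] = p ∷ []
  visits p (d ∷ w) = p ∷ visits (δ p d) w

  length-visits : ∀ p w → length (visits p w) ≡ suc (length w)
  length-visits p [] = refl
  length-visits p (d ∷ w) = cong suc (length-visits (δ p d) w)

  visits-suffix : ∀ p w {q} → q ∈ visits p w → Unique (visits p w) →
                  Σ (List (Fin k)) λ w′ → Unique (visits q w′) × foldl δ q w′ ≡ foldl δ p w
  visits-suffix p [] (here refl) u = [] , u , refl
  visits-suffix p (d ∷ w) (here refl) u = d ∷ w , u , refl
  visits-suffix p (d ∷ w) (there q∈) (_ ∷ u) = visits-suffix (δ p d) w q∈ u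

  loop-free : ∀ p w → Σ (List (Fin k)) λ w′ → Unique (visits p w′) × foldl δ p w′ ≡ foldl δ p w
  loop-free p [] = [] , [] ∷ [] , refl
  loop-free p (d ∷ w) with loop-free (δ p d) w
  ... | w′ , u , reach with p ∈? visits (δ p d) w′
  ...   | no p∉ = d ∷ w′ , ¬Any⇒All¬ _ p∉ ∷ u , reach
  ...   | yes p∈ with visits-suffix (δ p d) w′ p∈ u
  ...     | w″ , u″ , reach″ = w″ , u″ , trans reach″ reach

  reachable⇒reachableWithin : ∀ p w → ReachableWithin m p (foldl δ p w)
  reachable⇒reachableWithin p w with loop-free p w
  ... | w′ , u , reach = w′ , <⇒≤ (subst (_≤ m) (length-visits p w′) (Unique⇒length≤ u)) , reach

module Digits {k : ℕ} .{{_ : NonZero k}} (k≥2 : 2 ≤ k) where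

  digit : ℕ → Fin k
  digit n = fromℕ< (m%n<n n k)

  div-digit : ∀ n → n / k * k + toℕ (digit n) ≡ n
  div-digit n = begin
    n / k * k + toℕ (digit n) ≡⟨ cong (n / k * k +_) (toℕ-fromℕ< _) ⟩
    n / k * k + n % k         ≡⟨ +-comm (n / k * k) (n % k) ⟩
    n % k + n / k * k         ≡⟨ sym (m≡m%n+[m/n]*n n k) ⟩
    n                         ∎

  suc/k<suc : ∀ y → suc y / k < suc y
  suc/k<suc y = m/n<m (suc y) k k≥2

  digitsAux-fuel : ∀ {f g} y → y ≤ f → y ≤ g → digitsAux k f y ≡ digitsAux k g y
  digitsAux-fuel {zero} {zero} zero _ _ = refl
  digitsAux-fuel {zero} {suc _} zero _ _ = refl
  digitsAux-fuel {suc _} {zero} zero _ _ = refl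
  digitsAux-fuel {suc _} {suc _} zero _ _ = refl
  digitsAux-fuel {suc f} {suc g} (suc y) (s≤s y≤f) (s≤s y≤g) =
    cong (_∷ʳ digit (suc y)) (digitsAux-fuel (suc y / k) (/k≤ y≤f) (/k≤ y≤g))
    where
    /k≤ : ∀ {h} → y ≤ h → suc y / k ≤ h
    /k≤ y≤h = ≤-trans (≤-pred (suc/k<suc y)) y≤h

  digits-suc : ∀ y → digits k (suc y) ≡ digits k (suc y / k) ∷ʳ digit (suc y)
  digits-suc y = cong (_∷ʳ digit (suc y)) (digitsAux-fuel (suc y / k) (≤-pred (suc/k<suc y)) ≤-refl)

  [n*k+d]%k≡d : ∀ n (d : Fin k) → (n * k + toℕ d) % k ≡ toℕ d
  [n*k+d]%k≡d n d = begin
    (n * k + toℕ d) % k ≡⟨ cong (_% k) (+-comm (n * k) (toℕ d)) ⟩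
    (toℕ d + n * k) % k ≡⟨ [m+kn]%n≡m%n (toℕ d) n k ⟩
    toℕ d % k           ≡⟨ m<n⇒m%n≡m (toℕ<n d) ⟩
    toℕ d               ∎

  [n*k+d]/k≡n : ∀ n (d : Fin k) → (n * k + toℕ d) / k ≡ n
  [n*k+d]/k≡n n d = begin
    (n * k + toℕ d) / k     ≡⟨ +-distrib-/-∣ˡ (toℕ d) (n∣m*n n) ⟩
    n * k / k + toℕ d / k   ≡⟨ cong₂ _+_ (m*n/n≡m n k) (m<n⇒m/n≡0 (toℕ<n d)) ⟩
    n + 0                   ≡⟨ +-identityʳ n ⟩
    n                       ∎

  digit-n*k+d : ∀ n (d : Fin k) → digit (n * k + toℕ d) ≡ d
  digit-n*k+d n d = toℕ-injective (trans (toℕ-fromℕ< _) ([n*k+d]%k≡d n d))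

  digits-∷ʳ : ∀ n d → n * k + toℕ d ≢ 0 → digits k (n * k + toℕ d) ≡ digits k n ∷ʳ d
  digits-∷ʳ n d ≢0 with n * k + toℕ d in eq
  ... | zero = contradiction refl ≢0
  ... | suc y = begin
    digits k (suc y)                       ≡⟨ digits-suc y ⟩
    digits k (suc y / k) ∷ʳ digit (suc y)  ≡⟨ cong₂ (λ q r → digits k q ∷ʳ r) quot rem ⟩
    digits k n ∷ʳ d                        ∎
    where
    quot : suc y / k ≡ n
    quot = trans (cong (_/ k) (sym eq)) ([n*k+d]/k≡n n d)
    rem : digit (suc y) ≡ d
    rem = trans (cong digit (sym eq)) (digit-n*k+d n d)

  digit-induction : ∀ {ℓ} (P : ℕ → Set ℓ) → P 0 →
                    (∀ n d → n * k + toℕ d ≢ 0 → P n → P (n * k + toℕ d)) → ∀ n → P n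
  digit-induction P P0 step = <-rec P go
    where
    go : ∀ n → (∀ {m} → m < n → P m) → P n
    go zero _ = P0
    go (suc y) rec = subst P (div-digit (suc y))
      (step (suc y / k) (digit (suc y)) (λ ≡0 → contradiction (trans (sym (div-digit (suc y))) ≡0) λ ())
            (rec (suc/k<suc y)))

  shift-digit : ∀ n l s → n * k ^ suc l + s ≡ (n * k ^ l + s / k) * k + toℕ (digit s)
  shift-digit n l s = begin
    n * (k * k ^ l) + s                   ≡⟨ cong (n * (k * k ^ l) +_) (m≡m%n+[m/n]*n s k) ⟩
    n * (k * k ^ l) + (s % k + s / k * k) ≡⟨ solve 5 (λ n K q r k → n :* (k :* K) :+ (r :+ q :* k) := (n :* K :+ q) :* k :+ r)
                                                     refl n (k ^ l) (s / k) (s % k) k ⟩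
    (n * k ^ l + s / k) * k + s % k       ≡⟨ cong ((n * k ^ l + s / k) * k +_) (sym (toℕ-fromℕ< _)) ⟩
    (n * k ^ l + s / k) * k + toℕ (digit s) ∎
    where open +-*-Solver

appendDigits : ∀ {k} → ℕ → List (Fin k) → ℕ
appendDigits {k} = foldl (λ n d → n * k + toℕ d)

module _ {k : ℕ} .{{_ : NonZero k}} {Δ Δ′ : Set} where

  _⊗_ : DFAO k Δ → DFAO k Δ′ → DFAO k (Δ × Δ′)
  M ⊗ M′ = record
    { m  = A.m * B.m
    ; q₀ = combine A.q₀ B.q₀
    ; δ  = λ q d → combine (A.δ (proj₁ (split q)) d) (B.δ (proj₂ (split q)) d)
    ; τ  = λ q → A.τ (proj₁ (split q)) , B.τ (proj₂ (split q))
    }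
    where
    module A = DFAO M
    module B = DFAO M′
    split : Fin (A.m * B.m) → Fin A.m × Fin B.m
    split = remQuot B.m

  foldl-⊗ : ∀ M M′ p p′ w → foldl (DFAO.δ (M ⊗ M′)) (combine p p′) w
                          ≡ combine (foldl (DFAO.δ M) p w) (foldl (DFAO.δ M′) p′ w)
  foldl-⊗ M M′ p p′ [] = refl
  foldl-⊗ M M′ p p′ (d ∷ w) = begin
    foldl (DFAO.δ (M ⊗ M′)) (DFAO.δ (M ⊗ M′) (combine p p′) d) w
      ≡⟨ cong (λ qq → foldl (DFAO.δ (M ⊗ M′)) (combine (DFAO.δ M (proj₁ qq) d) (DFAO.δ M′ (proj₂ qq) d)) w)
              (remQuot-combine p p′) ⟩
    foldl (DFAO.δ (M ⊗ M′)) (combine (DFAO.δ M p d) (DFAO.δ M′ p′ d)) w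
      ≡⟨ foldl-⊗ M M′ (DFAO.δ M p d) (DFAO.δ M′ p′ d) w ⟩
    combine (foldl (DFAO.δ M) p (d ∷ w)) (foldl (DFAO.δ M′) p′ (d ∷ w)) ∎

  run-⊗ : ∀ M M′ n → run (M ⊗ M′) n ≡ (run M n , run M′ n)
  run-⊗ M M′ n = trans (cong (DFAO.τ (M ⊗ M′)) (foldl-⊗ M M′ (DFAO.q₀ M) (DFAO.q₀ M′) (digits k n)))
    (cong (λ qq → DFAO.τ M (proj₁ qq) , DFAO.τ M′ (proj₂ qq)) (remQuot-combine {DFAO.m M} {DFAO.m M′} _ _))

module Automata {k : ℕ} .{{_ : NonZero k}} (k≥2 : 2 ≤ k) where
  open Digits k≥2

  module _ {Δ : Set} (M : DFAO k Δ) where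
    open DFAO M

    state : ℕ → Fin m
    state n = foldl δ q₀ (digits k n)

    ZeroFixed : Set
    ZeroFixed = ∀ d → toℕ d ≡ 0 → δ q₀ d ≡ q₀

    state-∷ʳ : ∀ n d → n * k + toℕ d ≢ 0 → state (n * k + toℕ d) ≡ δ (state n) d
    state-∷ʳ n d ≢0 = trans (cong (foldl δ q₀) (digits-∷ʳ n d ≢0)) (foldl-∷ʳ δ q₀ d (digits k n))

    state-step : ZeroFixed → ∀ n d → state (n * k + toℕ d) ≡ δ (state n) d
    state-step fixed n d with n * k + toℕ d ℕ.≟ 0
    ... | no ≢0 = state-∷ʳ n d ≢0
    ... | yes ≡0 = begin
      state (n * k + toℕ d) ≡⟨ cong state ≡0 ⟩
      q₀                    ≡⟨ sym (fixed d (m+n≡0⇒n≡0 (n * k) ≡0)) ⟩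
      δ q₀ d                ≡⟨ cong (λ n → δ (state n) d) (sym (m*n≡0⇒m≡0 n k (m+n≡0⇒m≡0 (n * k) ≡0))) ⟩
      δ (state n) d         ∎

    state-foldl : ZeroFixed → ∀ n w → state (appendDigits n w) ≡ foldl δ (state n) w
    state-foldl fixed n [] = refl
    state-foldl fixed n (d ∷ w) =
      trans (state-foldl fixed (n * k + toℕ d) w) (cong (λ q → foldl δ q w) (state-step fixed n d))

    state-shift : ZeroFixed → ∀ n n′ → state n ≡ state n′ →
                  ∀ l s → s < k ^ l → state (n * k ^ l + s) ≡ state (n′ * k ^ l + s)
    state-shift fixed n n′ e zero zero _ =
      subst₂ (λ x y → state x ≡ state y) (sym (n*1+0≡n n)) (sym (n*1+0≡n n′)) e
      where
      n*1+0≡n : ∀ n → n * 1 + 0 ≡ n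
      n*1+0≡n n = trans (+-identityʳ (n * 1)) (*-identityʳ n)
    state-shift fixed n n′ e zero (suc s) (s≤s ())
    state-shift fixed n n′ e (suc l) s s<k^1+l = begin
      state (n * k ^ suc l + s)                        ≡⟨ cong state (shift-digit n l s) ⟩
      state ((n * k ^ l + s / k) * k + toℕ (digit s))  ≡⟨ state-step fixed (n * k ^ l + s / k) (digit s) ⟩
      δ (state (n * k ^ l + s / k)) (digit s)           ≡⟨ cong (λ q → δ q (digit s)) (state-shift fixed n n′ e l (s / k) s/k<k^l) ⟩
      δ (state (n′ * k ^ l + s / k)) (digit s)          ≡⟨ sym (state-step fixed (n′ * k ^ l + s / k) (digit s)) ⟩
      state ((n′ * k ^ l + s / k) * k + toℕ (digit s)) ≡⟨ cong state (sym (shift-digit n′ l s)) ⟩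
      state (n′ * k ^ suc l + s)                       ∎
      where
      s/k<k^l : s / k < k ^ l
      s/k<k^l = m<n*o⇒m/o<n (subst (s <_) (*-comm k (k ^ l)) s<k^1+l)

  -- A fresh initial state absorbs leading zeros; the other states are copies of
  -- those of M, entered with the first nonzero digit.
  module _ {Δ : Set} (M : DFAO k Δ) where
    open DFAO M

    enter : ℕ → Fin k → Fin (suc m)
    enter zero _ = zero
    enter (suc _) d = suc (δ q₀ d)

    fixZero-δ : Fin (suc m) → Fin k → Fin (suc m)
    fixZero-δ zero d = enter (toℕ d) d
    fixZero-δ (suc q) d = suc (δ q d)

    fixZero-τ : Fin (suc m) → Δ
    fixZero-τ zero = τ q₀
    fixZero-τ (suc q) = τ q

    fixZero : DFAO k Δ
    fixZero = record { m = suc m ; q₀ = zero ; δ = fixZero-δ ; τ = fixZero-τ }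

    fixZero-zeroFixed : ZeroFixed fixZero
    fixZero-zeroFixed d d≡0 = cong (λ j → enter j d) d≡0

    Tracks : ℕ → Set
    Tracks n = n ≡ 0 ⊎ state fixZero n ≡ suc (state M n)

    fixZero-δ-tracks : ∀ {n} d → Tracks n → n * k + toℕ d ≢ 0 →
                       fixZero-δ (state fixZero n) d ≡ suc (δ (state M n) d)
    fixZero-δ-tracks d (inj₂ e) _ = cong (λ q → fixZero-δ q d) e
    fixZero-δ-tracks d (inj₁ refl) ≢0 = enter-nonzero (toℕ d) ≢0
      where
      enter-nonzero : ∀ j → j ≢ 0 → enter j d ≡ suc (δ q₀ d)
      enter-nonzero zero j≢0 = contradiction refl j≢0
      enter-nonzero (suc _) _ = refl

    fixZero-tracks : ∀ n → Tracks n
    fixZero-tracks = digit-induction Tracks (inj₁ refl) λ n d ≢0 tracks → inj₂ (begin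
      state fixZero (n * k + toℕ d)        ≡⟨ state-∷ʳ fixZero n d ≢0 ⟩
      fixZero-δ (state fixZero n) d        ≡⟨ fixZero-δ-tracks d tracks ≢0 ⟩
      suc (δ (state M n) d)                ≡⟨ cong suc (sym (state-∷ʳ M n d ≢0)) ⟩
      suc (state M (n * k + toℕ d))        ∎)

    run-fixZero : ∀ n → run fixZero n ≡ run M n
    run-fixZero n with fixZero-tracks n
    ... | inj₁ refl = refl
    ... | inj₂ e = cong fixZero-τ e

  module _ {Δ : Set} (M : DFAO k Δ) (fixed : ZeroFixed M) where
    open DFAO M
    open Reachability δ

    representative : Fin m → ℕ
    representative t with reachableWithin? m q₀ t
    ... | yes (w , _ , _) = appendDigits 0 w
    ... | no _ = 0

    state-representative : ∀ n → state M (representative (state M n)) ≡ state M n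
    state-representative n with reachableWithin? m q₀ (state M n)
    ... | yes (w , _ , reach) = trans (state-foldl M fixed 0 w) reach
    ... | no unreachable = ⊥-elim (unreachable (reachable⇒reachableWithin q₀ (digits k n)))

    automatic-if-state-determined : {C : Set} (c : ℕ → C) →
      (∀ n n′ → state M n ≡ state M n′ → c n ≡ c n′) → Automatic k c
    automatic-if-state-determined c determined =
      record { m = m ; q₀ = q₀ ; δ = δ ; τ = λ t → c (representative t) } ,
      λ n → determined _ n (state-representative n)

  AgreeOnExtensions : {Δ : Set} → (a b : ℕ → Δ) → ℕ → Set
  AgreeOnExtensions a b n = ∀ (λ′ s : ℕ) → s < k ^ λ′ → a (n * k ^ λ′ + s) ≡ b (n * k ^ λ′ + s)

  agreeOnExtensions-transfer : {Δ : Set} {a b : ℕ → Δ} (M : DFAO k (Δ × Δ)) → ZeroFixed M →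
    (∀ n → run M n ≡ (a n , b n)) →
    ∀ n n′ → state M n ≡ state M n′ → AgreeOnExtensions a b n → AgreeOnExtensions a b n′
  agreeOnExtensions-transfer {a = a} {b} M fixed runs n n′ e agree l s s<k^l =
    trans (sym (proj₁ same)) (trans (agree l s s<k^l) (proj₂ same))
    where
    x x′ : ℕ
    x = n * k ^ l + s
    x′ = n′ * k ^ l + s
    same : a x ≡ a x′ × b x ≡ b x′
    same = ,-injective (begin
      (a x , b x)  ≡⟨ sym (runs x) ⟩
      run M x      ≡⟨ cong (DFAO.τ M) (state-shift M fixed n n′ e l s s<k^l) ⟩
      run M x′     ≡⟨ runs x′ ⟩
      (a x′ , b x′) ∎)

indicator-cong : ∀ {P Q : Set} {x y : ℕ} → (P → x ≡ 1) × (¬ P → x ≡ 0) → (Q → y ≡ 1) × (¬ Q → y ≡ 0) →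
                 (P → Q) → (Q → P) → x ≡ y
indicator-cong {P} {x = x} {y} (P⇒1 , ¬P⇒0) (Q⇒1 , ¬Q⇒0) P⇒Q Q⇒P with x ℕ.≟ y
... | yes x≡y = x≡y
... | no x≢y = ⊥-elim (¬¬P λ p → x≢y (trans (P⇒1 p) (sym (Q⇒1 (P⇒Q p)))))
  where
  -- P need not be decidable, but x ≢ y refutes both P and ¬ P.
  ¬¬P : ¬ ¬ P
  ¬¬P ¬p = x≢y (trans (¬P⇒0 ¬p) (sym (¬Q⇒0 λ q → ¬p (Q⇒P q))))

lemma4p2 : (k : ℕ) → .{{_ : NonZero k}} → 2 ≤ k → {Δ : Set} → (a b : ℕ → Δ)
    → Automatic k a → Automatic k b
    → (c : ℕ → ℕ)
    → (∀ n → ((∀ (λ′ s : ℕ) → s < k ^ λ′ → a (n * k ^ λ′ + s) ≡ b (n * k ^ λ′ + s)) → c n ≡ 1)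
           × (¬ (∀ (λ′ s : ℕ) → s < k ^ λ′ → a (n * k ^ λ′ + s) ≡ b (n * k ^ λ′ + s)) → c n ≡ 0))
    → Automatic k c
lemma4p2 k k≥2 {Δ} a b (A , runA) (B , runB) c c-indicator =
  automatic-if-state-determined M fixed c λ n n′ e →
    indicator-cong (c-indicator n) (c-indicator n′) (transfer n n′ e) (transfer n′ n (sym e))
  where
  open Automata k≥2

  M : DFAO k (Δ × Δ)
  M = fixZero (A ⊗ B)

  fixed : ZeroFixed M
  fixed = fixZero-zeroFixed (A ⊗ B)

  runs : ∀ n → run M n ≡ (a n , b n)
  runs n = trans (run-fixZero (A ⊗ B) n) (trans (run-⊗ A B n) (cong₂ _,_ (runA n) (runB n)))

  transfer : ∀ n n′ → state M n ≡ state M n′ → AgreeOnExtensions a b n → AgreeOnExtensions a b n′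
  transfer = agreeOnExtensions-transfer M fixed runs
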